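{- Let $a, b$ be relatively prime positive integers such that $\frac{a}{b} > 1$, and let $w(i)$ be the letter at position $i$ in $\textbf{w}_{a/b}$. Then $w(i) = O(\sqrt{i})$.
   Context: Words are finite or infinite sequences of letters, indexed from position $0$; a factor is a contiguous subword. For relatively prime positive integers $a,b$ and a nonempty word $v$ whose length is divisible by $b$, define $v^{a/b} = v^{\lfloor a/b \rfloor} v_0 v_1 \cdots v_{t-1}$, where $t = |v|\,(a/b - \lfloor a/b\rfloor)$; such a word is called an $\frac{a}{b}$-power. A word is $\frac{a}{b}$-power-free if none of its factors is an $\frac{a}{b}$-power. For $\frac{a}{b} > 1$, $\textbf{w}_{a/b}$ denotes the lexicographically least infinite word over the alphabet $\mathbb{Z}_{\geq 0}$ that is $\frac{a}{b}$-power-free. -}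

module Defs where

open import Data.Nat using (ℕ; _+_; _*_; _<_; NonZero)
open import Data.Nat.DivMod using (_/_; _%_)
open import Data.Nat.Divisibility using (_∣_)
open import Data.List using (List; []; _++_; concat; replicate; take; length; applyUpTo)
open import Data.Product using (∃-syntax; _×_)
open import Relation.Binary.PropositionalEquality using (_≡_; _≢_)
open import Relation.Nullary using (¬_)

-- Infinite words over the alphabet ℤ≥0, indexed from position 0.
Word : Set
Word = ℕ → ℕ

-- v^{a/b} = v^{⌊a/b⌋} v₀ ⋯ v_{t-1},  t = |v| (a/b - ⌊a/b⌋) = |v| (a mod b) / b
-- (exact division when b ∣ |v|).
power : (a b : ℕ) .{{_ : NonZero b}} → List ℕ → List ℕ
power a b v = concat (replicate (a / b) v) ++ take ((length v * (a % b)) / b) v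

IsPower : (a b : ℕ) .{{_ : NonZero b}} → List ℕ → Set
IsPower a b x = ∃[ v ] (v ≢ [] × b ∣ length v × x ≡ power a b v)

factor : Word → ℕ → ℕ → List ℕ
factor w s n = applyUpTo (λ i → w (s + i)) n

PowerFree : (a b : ℕ) .{{_ : NonZero b}} → Word → Set
PowerFree a b w = ∀ s n → ¬ IsPower a b (factor w s n)

LexLess : Word → Word → Set
LexLess u w = ∃[ n ] ((∀ i → i < n → u i ≡ w i) × u n < w n)

IsLexLeastPowerFree : (a b : ℕ) .{{_ : NonZero b}} → Word → Set
IsLexLeastPowerFree a b w =
  PowerFree a b w × (∀ u → PowerFree a b u → ¬ LexLess u w)

-- Say the letter j is blocked at position i at scale r if w has period b·r on the window
-- [i + 1 - a·r, i) and j = w(i - b·r): writing j at i would complete an a/b-power of length a·r.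
-- In the lexicographically least power-free word every letter j < w(i) is blocked at i, since
-- otherwise w(0)…w(i-1) j followed by ever larger fresh letters is a smaller power-free word.
-- Two blocks at scales r < r′ < 2r overlap in an a/b-power of period b·(r′ - r) (a Fine–Wilf
-- step), so the w(i) blocked letters have scales in pairwise distinct dyadic ranges; as a·r ≤ i + 1
-- for every scale, this forces 2^w(i) ≤ i + 1 and hence w(i)² ≤ 4i.
module Submission where

open import Defs
open import Data.Nat
open import Data.Nat.Properties
open import Data.Nat.DivMod using (m≡m%n+[m/n]*n; m%n<n; m*n/n≡m; m≥n⇒m/n>0)
open import Data.Nat.Divisibility using (divides)
open import Data.Nat.Coprimality using (Coprime)
open import Data.Nat.Tactic.RingSolver using (solve)
open import Data.List using (List; []; _∷_; _++_; concat; replicate; take; drop; length; applyUpTo)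
open import Data.List.Properties using (length-++; length-applyUpTo; length-take; ++-assoc; ++-identityʳ; take++drop≡id)
open import Data.Product using (∃-syntax; _×_; _,_; proj₁; proj₂)
open import Relation.Binary.PropositionalEquality
open import Relation.Binary using (tri<; tri≈; tri>)
open import Relation.Nullary using (¬_; yes; no; ¬¬-map)
open import Relation.Nullary.Decidable using (decidable-stable)
open import Data.Empty using (⊥; ⊥-elim)
open import Data.Sum using (inj₁; inj₂)
open import Data.Fin using (Fin; toℕ; fromℕ<)
open import Data.Fin.Properties using (toℕ<n; toℕ-fromℕ<; toℕ-injective; injective⇒≤; all?; ¬∀⟶∃¬)

-- Total indexing into a list (0 beyond the end), to read a factor back as a function.
at : List ℕ → ℕ → ℕ
at []       _       = 0
at (x ∷ _)  zero    = x
at (_ ∷ xs) (suc t) = at xs t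

at-++ˡ : ∀ xs ys {t} → t < length xs → at (xs ++ ys) t ≡ at xs t
at-++ˡ (x ∷ xs) ys {zero}  _         = refl
at-++ˡ (x ∷ xs) ys {suc t} (s≤s t<) = at-++ˡ xs ys t<

at-++ʳ : ∀ xs ys t → at (xs ++ ys) (length xs + t) ≡ at ys t
at-++ʳ []       ys t = refl
at-++ʳ (x ∷ xs) ys t = at-++ʳ xs ys t

at-applyUpTo : ∀ (f : ℕ → ℕ) n {t} → t < n → at (applyUpTo f n) t ≡ f t
at-applyUpTo f (suc n) {zero}  _         = refl
at-applyUpTo f (suc n) {suc t} (s≤s t<) = at-applyUpTo (λ i → f (suc i)) n t<

applyUpTo-cong : ∀ {f g : ℕ → ℕ} n → (∀ t → t < n → f t ≡ g t) → applyUpTo f n ≡ applyUpTo g n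
applyUpTo-cong zero    _  = refl
applyUpTo-cong (suc n) eq =
  cong₂ _∷_ (eq 0 z<s) (applyUpTo-cong n (λ t t< → eq (suc t) (s<s t<)))

applyUpTo-+ : ∀ (f : ℕ → ℕ) m n → applyUpTo f (m + n) ≡ applyUpTo f m ++ applyUpTo (λ t → f (m + t)) n
applyUpTo-+ f zero    n = refl
applyUpTo-+ f (suc m) n = cong (f 0 ∷_) (applyUpTo-+ (λ i → f (suc i)) m n)

take-applyUpTo : ∀ (f : ℕ → ℕ) {m n} → m ≤ n → take m (applyUpTo f n) ≡ applyUpTo f m
take-applyUpTo f {zero}              _         = refl
take-applyUpTo f {suc m} {suc n} (s≤s m≤n) = cong (f 0 ∷_) (take-applyUpTo (λ i → f (suc i)) m≤n)

at-factor : ∀ f s n {t} → t < n → at (factor f s n) t ≡ f (s + t)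
at-factor f s n = at-applyUpTo (λ i → f (s + i)) n

factor-++ : ∀ f s m n → factor f s (m + n) ≡ factor f s m ++ factor f (s + m) n
factor-++ f s m n = trans (applyUpTo-+ _ m n)
  (cong (factor f s m ++_) (applyUpTo-cong n λ t _ → cong f (sym (+-assoc s m t))))

factor-prefix : ∀ f s {m n} → m ≤ n → take m (factor f s n) ≡ factor f s m
factor-prefix f s = take-applyUpTo (λ i → f (s + i))

length-repeat : ∀ q (v : List ℕ) → length (concat (replicate q v)) ≡ q * length v
length-repeat zero    v = refl
length-repeat (suc q) v = trans (length-++ v) (cong (length v +_) (length-repeat q v))

repeat-comm : ∀ q (v : List ℕ) → v ++ concat (replicate q v) ≡ concat (replicate q v) ++ v
repeat-comm zero    v = ++-identityʳ v
repeat-comm (suc q) v = trans (cong (v ++_) (repeat-comm q v)) (sym (++-assoc v _ v))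

repeat-suc : ∀ {q} (v : List ℕ) → 1 ≤ q → concat (replicate q v) ≡ v ++ concat (replicate (q ∸ 1) v)
repeat-suc {suc q} v _ = refl

-- v^q (prefix of v) can be read both as v followed by y and as y followed by z:
-- this overlap is what makes a fractional power periodic.
repeat-overlap : ∀ q t (v : List ℕ) →
  v ++ (concat (replicate q v) ++ take t v) ≡ (concat (replicate q v) ++ take t v) ++ (drop t v ++ take t v)
repeat-overlap q t v = begin
  v ++ (R ++ T)               ≡⟨ sym (++-assoc v R T) ⟩
  (v ++ R) ++ T               ≡⟨ cong (_++ T) (repeat-comm q v) ⟩
  (R ++ v) ++ T               ≡⟨ cong (λ u → (R ++ u) ++ T) (sym (take++drop≡id t v)) ⟩
  (R ++ (T ++ D)) ++ T        ≡⟨ cong (_++ T) (sym (++-assoc R T D)) ⟩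
  ((R ++ T) ++ D) ++ T        ≡⟨ ++-assoc (R ++ T) D T ⟩
  (R ++ T) ++ (D ++ T)        ∎
  where
  open ≡-Reasoning
  R = concat (replicate q v)
  T = take t v
  D = drop t v

overlap-period : ∀ v y z → v ++ y ≡ y ++ z → ∀ {t} → t < length y →
  at (v ++ y) t ≡ at (v ++ y) (length v + t)
overlap-period v y z v++y≡y++z {t} t<len = begin
  at (v ++ y) t               ≡⟨ cong (λ l → at l t) v++y≡y++z ⟩
  at (y ++ z) t               ≡⟨ at-++ˡ y z t<len ⟩
  at y t                      ≡⟨ sym (at-++ʳ v y t) ⟩
  at (v ++ y) (length v + t)  ∎
  where open ≡-Reasoning

HasPeriod : Word → (s e p : ℕ) → Set
HasPeriod f s e p = ∀ x → s ≤ x → x + p < e → f x ≡ f (x + p)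

HasPeriod-restrict : ∀ {f s e p s′ e′} → s ≤ s′ → e′ ≤ e → HasPeriod f s e p → HasPeriod f s′ e′ p
HasPeriod-restrict s≤s′ e′≤e per x s′≤x x+p<e′ = per x (≤-trans s≤s′ s′≤x) (<-≤-trans x+p<e′ e′≤e)

HasPeriod-transfer : ∀ {f g s e p} → (∀ x → x < e → f x ≡ g x) → HasPeriod f s e p → HasPeriod g s e p
HasPeriod-transfer {p = p} agree per x s≤x x+p<e =
  trans (sym (agree x (≤-<-trans (m≤m+n x p) x+p<e))) (trans (per x s≤x x+p<e) (agree (x + p) x+p<e))

relative⇒HasPeriod : ∀ {f s n p} → (∀ t → t + p < n → f (s + t) ≡ f (s + t + p)) → HasPeriod f s (s + n) p
relative⇒HasPeriod {f} {s} {n} {p} rel x s≤x x+p<s+n with m≤n⇒∃[o]m+o≡n s≤x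
... | t , refl = rel t (+-cancelˡ-< s (t + p) n (subst (_< s + n) (+-assoc s t p) x+p<s+n))

period-difference : ∀ {f s e p q} → HasPeriod f s (e + q) (p + q) → HasPeriod f (s + p) (e + q) q →
  HasPeriod f s e p
period-difference {f} {s} {e} {p} {q} per₁ per₂ x s≤x x+p<e = begin
  f x              ≡⟨ per₁ x s≤x (subst (_< e + q) (+-assoc x p q) (+-monoˡ-< q x+p<e)) ⟩
  f (x + (p + q))  ≡⟨ cong f (sym (+-assoc x p q)) ⟩
  f (x + p + q)    ≡⟨ sym (per₂ (x + p) (+-monoˡ-≤ p s≤x) (+-monoˡ-< q x+p<e)) ⟩
  f (x + p)        ∎
  where open ≡-Reasoning

prefix-max : Word → ℕ → ℕ
prefix-max f zero    = 0
prefix-max f (suc i) = f i ⊔ prefix-max f i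

≤-prefix-max : ∀ f {x i} → x < i → f x ≤ prefix-max f i
≤-prefix-max f {x} {suc i} x<1+i with m≤n⇒m<n∨m≡n (≤-pred x<1+i)
... | inj₁ x<i  = ≤-trans (≤-prefix-max f x<i) (m≤n⊔m (f i) (prefix-max f i))
... | inj₂ refl = m≤m⊔n (f x) (prefix-max f x)

fresh-period-end : ∀ {f i s e p} → (∀ x y → x < y → i < y → f x < f y) → 0 < p → s + p < e →
  HasPeriod f s e p → e ≤ suc i
fresh-period-end {f} {i} {s} {e} {p} fresh 0<p s+p<e per with e ≤? suc i | m≤n⇒∃[o]m+o≡n s+p<e
... | yes e≤1+i | _          = e≤1+i
... | no  e≰1+i | k , 1+s+p+k≡e = ⊥-elim (<⇒≢ (fresh x (x + p) (m<m+n x 0<p) i<x+p) (per x (m≤m+n s k) x+p<e))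
  where
  x = s + k
  x+p≡s+p+k : x + p ≡ s + p + k
  x+p≡s+p+k = trans (+-assoc s k p) (trans (cong (s +_) (+-comm k p)) (sym (+-assoc s p k)))
  x+p<e : x + p < e
  x+p<e = subst (_≤ e) (cong suc (sym x+p≡s+p+k)) (≤-reflexive 1+s+p+k≡e)
  i<x+p : i < x + p
  i<x+p = subst (i <_) (sym x+p≡s+p+k) (≤-pred (subst (suc (suc i) ≤_) (sym 1+s+p+k≡e) (≰⇒> e≰1+i)))

period-shift : ∀ f s p m → HasPeriod f s (s + p + m) p → factor f (s + p) m ≡ factor f s m
period-shift f s p m per = applyUpTo-cong m λ t t<m → begin
  f (s + p + t)  ≡⟨ cong f (reorder t) ⟩
  f (s + t + p)  ≡⟨ sym (per (s + t) (m≤m+n s t) (s+t+p<s+p+m t<m)) ⟩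
  f (s + t)      ∎
  where
  open ≡-Reasoning
  reorder : ∀ t → s + p + t ≡ s + t + p
  reorder t = solve (s ∷ p ∷ t ∷ [])
  s+t+p<s+p+m : ∀ {t} → t < m → s + t + p < s + p + m
  s+t+p<s+p+m {t} t<m = subst (_< s + p + m) (reorder t) (+-monoʳ-< (s + p) t<m)

periodic-factor : ∀ f s p q t → t ≤ p → HasPeriod f s (s + (q * p + t)) p →
  factor f s (q * p + t) ≡ concat (replicate q (factor f s p)) ++ take t (factor f s p)
periodic-factor f s p zero    t t≤p _   = sym (factor-prefix f s t≤p)
periodic-factor f s p (suc q) t t≤p per = begin
  factor f s ((p + q * p) + t)               ≡⟨ cong (factor f s) (+-assoc p (q * p) t) ⟩
  factor f s (p + (q * p + t))               ≡⟨ factor-++ f s p (q * p + t) ⟩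
  V ++ factor f (s + p) (q * p + t)          ≡⟨ cong (V ++_) (period-shift f s p (q * p + t) per′) ⟩
  V ++ factor f s (q * p + t)                ≡⟨ cong (V ++_) (periodic-factor f s p q t t≤p per″) ⟩
  V ++ (concat (replicate q V) ++ take t V)  ≡⟨ sym (++-assoc V _ _) ⟩
  (V ++ concat (replicate q V)) ++ take t V  ∎
  where
  open ≡-Reasoning
  V = factor f s p
  end≡ : s + ((p + q * p) + t) ≡ s + p + (q * p + t)
  end≡ = solve (s ∷ p ∷ q ∷ t ∷ [])
  per′ : HasPeriod f s (s + p + (q * p + t)) p
  per′ = subst (λ e → HasPeriod f s e p) end≡ per
  per″ : HasPeriod f s (s + (q * p + t)) p
  per″ = HasPeriod-restrict ≤-refl (+-monoʳ-≤ s (+-monoˡ-≤ t (m≤n+m (q * p) p))) per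

module FractionalPowers (a b : ℕ) .{{_ : NonZero b}} where

  tail-length : ∀ (v : List ℕ) r → length v ≡ r * b → length v * (a % b) / b ≡ r * (a % b)
  tail-length v r |v| = begin
    length v * (a % b) / b  ≡⟨ cong (λ ℓ → ℓ * (a % b) / b) |v| ⟩
    r * b * (a % b) / b     ≡⟨ cong (_/ b) (commute r (a % b)) ⟩
    r * (a % b) * b / b     ≡⟨ m*n/n≡m (r * (a % b)) b ⟩
    r * (a % b)             ∎
    where
    open ≡-Reasoning
    commute : ∀ r m → r * b * m ≡ r * m * b
    commute r m = solve (r ∷ m ∷ b ∷ [])

  tail-≤ : ∀ r → r * (a % b) ≤ r * b
  tail-≤ r = *-monoʳ-≤ r (<⇒≤ (m%n<n a b))

  -- a·r = (a div b)·(r·b) + r·(a mod b): the length of v^{a/b} for |v| = r·b.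
  length-split : ∀ r → a * r ≡ a / b * (r * b) + r * (a % b)
  length-split r = begin
    a * r                          ≡⟨ cong (_* r) (m≡m%n+[m/n]*n a b) ⟩
    (a % b + a / b * b) * r        ≡⟨ distribute (a % b) (a / b) r ⟩
    a / b * (r * b) + r * (a % b)  ∎
    where
    open ≡-Reasoning
    distribute : ∀ m q r → (m + q * b) * r ≡ q * (r * b) + r * m
    distribute m q r = solve (m ∷ q ∷ r ∷ b ∷ [])

  length-power : ∀ (v : List ℕ) r → length v ≡ r * b → length (power a b v) ≡ a * r
  length-power v r |v| = begin
    length (power a b v)
      ≡⟨ length-++ (concat (replicate (a / b) v)) ⟩
    length (concat (replicate (a / b) v)) + length (take k v)
      ≡⟨ cong₂ _+_ (length-repeat (a / b) v) (length-take k v) ⟩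
    a / b * length v + k ⊓ length v
      ≡⟨ cong₂ (λ ℓ κ → a / b * ℓ + κ ⊓ ℓ) |v| (tail-length v r |v|) ⟩
    a / b * (r * b) + r * (a % b) ⊓ (r * b)
      ≡⟨ cong (a / b * (r * b) +_) (m≤n⇒m⊓n≡m (tail-≤ r)) ⟩
    a / b * (r * b) + r * (a % b)
      ≡⟨ sym (length-split r) ⟩
    a * r ∎
    where
    open ≡-Reasoning
    k = length v * (a % b) / b

  periodic⇒power : ∀ f s r → 1 ≤ r → HasPeriod f s (s + a * r) (b * r) → IsPower a b (factor f s (a * r))
  periodic⇒power f s r 1≤r per = v , v≢[] , divides r |v| , (begin
    factor f s (a * r)
      ≡⟨ cong (factor f s) (length-split r) ⟩
    factor f s (a / b * (r * b) + r * (a % b))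
      ≡⟨ periodic-factor f s (r * b) (a / b) (r * (a % b)) (tail-≤ r) per′ ⟩
    concat (replicate (a / b) v) ++ take (r * (a % b)) v
      ≡⟨ cong (λ k → concat (replicate (a / b) v) ++ take k v) (sym (tail-length v r |v|)) ⟩
    power a b v ∎)
    where
    open ≡-Reasoning
    v = factor f s (r * b)
    |v| : length v ≡ r * b
    |v| = length-applyUpTo _ (r * b)
    v≢[] : v ≢ []
    v≢[] v≡[] = <⇒≢ (*-mono-≤ 1≤r (>-nonZero⁻¹ b)) (sym (trans (sym |v|) (cong length v≡[])))
    per′ : HasPeriod f s (s + (a / b * (r * b) + r * (a % b))) (r * b)
    per′ = subst₂ (HasPeriod f s) (cong (s +_) (length-split r)) (*-comm b r) per

  power⇒periodic : b ≤ a → ∀ f s n → IsPower a b (factor f s n) →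
    ∃[ r ] (1 ≤ r × n ≡ a * r × HasPeriod f s (s + n) (b * r))
  power⇒periodic b≤a f s n (v , v≢[] , divides r |v| , X≡power) =
    r , multiplier-positive r v≢[] |v| , n≡ar , relative⇒HasPeriod relative
    where
    X = factor f s n
    k = length v * (a % b) / b
    y = concat (replicate (a / b ∸ 1) v) ++ take k v
    X≡v++y : X ≡ v ++ y
    X≡v++y = trans X≡power
      (trans (cong (_++ take k v) (repeat-suc v (m≥n⇒m/n>0 b≤a))) (++-assoc v _ _))
    multiplier-positive : ∀ r {v : List ℕ} → v ≢ [] → length v ≡ r * b → 1 ≤ r
    multiplier-positive zero    {[]}    v≢[] _  = ⊥-elim (v≢[] refl)
    multiplier-positive zero    {_ ∷ _} _    ()
    multiplier-positive (suc r) _       _    = s≤s z≤n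
    n≡ar : n ≡ a * r
    n≡ar = trans (sym (length-applyUpTo _ n)) (trans (cong length X≡power) (length-power v r |v|))
    n≡|v|+|y| : n ≡ length v + length y
    n≡|v|+|y| = trans (sym (length-applyUpTo _ n)) (trans (cong length X≡v++y) (length-++ v))
    |v|≡br : length v ≡ b * r
    |v|≡br = trans |v| (*-comm r b)
    relative : ∀ t → t + b * r < n → f (s + t) ≡ f (s + t + b * r)
    relative t t+br<n = begin
      f (s + t)                   ≡⟨ sym (at-factor f s n (≤-<-trans (m≤n+m t (length v)) |v|+t<n)) ⟩
      at X t                      ≡⟨ cong (λ l → at l t) X≡v++y ⟩
      at (v ++ y) t               ≡⟨ overlap-period v y _ (repeat-overlap (a / b ∸ 1) k v) t<|y| ⟩
      at (v ++ y) (length v + t)  ≡⟨ cong (λ l → at l (length v + t)) (sym X≡v++y) ⟩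
      at X (length v + t)         ≡⟨ at-factor f s n |v|+t<n ⟩
      f (s + (length v + t))      ≡⟨ cong f (trans (cong (λ ℓ → s + (ℓ + t)) |v|≡br) (reorder s (b * r) t)) ⟩
      f (s + t + b * r)           ∎
      where
      open ≡-Reasoning
      reorder : ∀ x y z → x + (y + z) ≡ x + z + y
      reorder x y z = solve (x ∷ y ∷ z ∷ [])
      |v|+t<n : length v + t < n
      |v|+t<n = subst (_< n) (trans (+-comm t (b * r)) (cong (_+ t) (sym |v|≡br))) t+br<n
      t<|y| : t < length y
      t<|y| = +-cancelˡ-< (length v) t (length y) (subst (length v + t <_) n≡|v|+|y| |v|+t<n)

exchange-< : ∀ {a b δ r} → b < a → δ < r → a * δ + b * r < b * δ + a * r
exchange-< {a} {b} {δ} {r} b<a δ<r with m≤n⇒∃[o]m+o≡n δ<r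
... | t , refl = begin-strict
  a * δ + b * (suc δ + t)          ≡⟨ expand ⟩
  (a * δ + b * δ) + b * suc t      <⟨ +-monoʳ-< (a * δ + b * δ) (*-monoˡ-< (suc t) b<a) ⟩
  (a * δ + b * δ) + a * suc t      ≡⟨ sym expand′ ⟩
  b * δ + a * (suc δ + t)          ∎
  where
  open ≤-Reasoning
  expand : a * δ + b * (suc δ + t) ≡ (a * δ + b * δ) + b * suc t
  expand = solve (a ∷ b ∷ δ ∷ t ∷ [])
  expand′ : b * δ + a * (suc δ + t) ≡ (a * δ + b * δ) + a * suc t
  expand′ = solve (a ∷ b ∷ δ ∷ t ∷ [])

dyadic : ∀ r → 1 ≤ r → ∃[ e ] (2 ^ e ≤ r × r < 2 ^ suc e)
dyadic (suc zero)    _ = 0 , ≤-refl , s≤s (s≤s z≤n)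
dyadic (suc (suc r)) _ with dyadic (suc r) (s≤s z≤n)
... | e , lo , hi with suc (suc r) <? 2 ^ suc e
...   | yes r+2<2^[1+e] = e , m≤n⇒m≤1+n lo , r+2<2^[1+e]
...   | no  r+2≮2^[1+e] = suc e , ≮⇒≥ r+2≮2^[1+e] ,
  ≤-<-trans hi (m<m+n (2 ^ suc e) (subst (0 <_) (sym (+-identityʳ (2 ^ suc e))) (m^n>0 2 (suc e))))

injective-unbounded : ∀ m (f : Fin (suc m) → ℕ) → (∀ {x y} → f x ≡ f y → x ≡ y) → ∃[ x ] m ≤ f x
injective-unbounded m f f-injective with all? (λ x → f x <? m)
... | yes all-below = ⊥-elim (n≮n m (injective⇒≤ {f = g} g-injective))
  where
  g : Fin (suc m) → Fin m
  g x = fromℕ< (all-below x)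
  g-injective : ∀ {x y} → g x ≡ g y → x ≡ y
  g-injective {x} {y} gx≡gy =
    f-injective (trans (sym (toℕ-fromℕ< (all-below x))) (trans (cong toℕ gx≡gy) (toℕ-fromℕ< (all-below y))))
... | no not-all-below with ¬∀⟶∃¬ (suc m) (λ x → f x < m) (λ x → f x <? m) not-all-below
...   | x , fx≮m = x , ≮⇒≥ fx≮m

doubling : ∀ X → 4 * X + 4 * X ≡ 4 * (2 * X)
doubling X = solve (X ∷ [])

linear≤exp : ∀ k → 2 * k + 1 ≤ 4 * 2 ^ k
linear≤exp zero    = s≤s z≤n
linear≤exp (suc k) = begin
  2 * suc k + 1            ≡⟨ solve (k ∷ []) ⟩
  (2 * k + 1) + 2          ≤⟨ +-mono-≤ (linear≤exp k) (≤-trans (s≤s (s≤s z≤n)) (*-monoʳ-≤ 4 (m^n>0 2 k))) ⟩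
  4 * 2 ^ k + 4 * 2 ^ k    ≡⟨ doubling (2 ^ k) ⟩
  4 * (2 * 2 ^ k)          ∎
  where open ≤-Reasoning

square≤exp : ∀ k → k * k + 4 ≤ 4 * 2 ^ k
square≤exp zero    = ≤-refl
square≤exp (suc k) = begin
  suc k * suc k + 4             ≡⟨ solve (k ∷ []) ⟩
  (k * k + 4) + (2 * k + 1)     ≤⟨ +-mono-≤ (square≤exp k) (linear≤exp k) ⟩
  4 * 2 ^ k + 4 * 2 ^ k         ≡⟨ doubling (2 ^ k) ⟩
  4 * (2 * 2 ^ k)               ∎
  where open ≤-Reasoning

square-bound : ∀ {k i} → 2 ^ k ≤ suc i → k * k ≤ 4 * i
square-bound {k} {i} 2^k≤1+i = +-cancelʳ-≤ 4 (k * k) (4 * i) (begin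
  k * k + 4      ≤⟨ square≤exp k ⟩
  4 * 2 ^ k      ≤⟨ *-monoʳ-≤ 4 2^k≤1+i ⟩
  4 * suc i      ≡⟨ solve (i ∷ []) ⟩
  4 * i + 4      ∎)
  where open ≤-Reasoning

¬¬-bounded-∀ : ∀ {P : ℕ → Set} k → (∀ j → j < k → ¬ ¬ P j) → ¬ ¬ (∀ j → j < k → P j)
¬¬-bounded-∀ zero    _   none = none (λ _ ())
¬¬-bounded-∀ {P} (suc k) ¬¬P none =
  ¬¬-bounded-∀ k (λ j j<k → ¬¬P j (m<n⇒m<1+n j<k)) λ below →
    ¬¬P k (n<1+n k) λ Pk → none (extend below Pk)
  where
  extend : (∀ j → j < k → P j) → P k → ∀ j → j < suc k → P j
  extend below Pk j j<1+k with m≤n⇒m<n∨m≡n (≤-pred j<1+k)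
  ... | inj₁ j<k  = below j j<k
  ... | inj₂ refl = Pk

module PowerFreeWord (a b : ℕ) .{{_ : NonZero b}} (b<a : b < a) (w : Word) (pf : PowerFree a b w) where
  open FractionalPowers a b

  -- At scale r, position i blocks the letter j: w has period b·r on [s, i) where s + a·r = i + 1,
  -- and j occurs b·r positions before i, so writing j at i would complete an a/b-power.
  record Blocks (i r j : ℕ) : Set where
    field
      positive  : 1 ≤ r
      origin    : ℕ
      ends-at-i : origin + a * r ≡ suc i
      periodic  : HasPeriod w origin i (b * r)
      source    : ℕ
      source+br : source + b * r ≡ i
      letter    : w source ≡ j

  period<length : ∀ {r} → 1 ≤ r → b * r < a * r
  period<length {r} 1≤r = *-monoˡ-< r {{>-nonZero 1≤r}} b<a

  origin-shift : ∀ {i r r′ δ j j′} (B : Blocks i r j) (B′ : Blocks i r′ j′) → r + δ ≡ r′ →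
    Blocks.origin B′ + a * δ ≡ Blocks.origin B
  origin-shift {i} {r} {r′} {δ} B B′ r+δ≡r′ = +-cancelʳ-≡ (a * r) _ _ (begin
    origin′ + a * δ + a * r  ≡⟨ factor-out origin′ a δ r ⟩
    origin′ + a * (r + δ)    ≡⟨ cong (λ ρ → origin′ + a * ρ) r+δ≡r′ ⟩
    origin′ + a * r′         ≡⟨ trans (Blocks.ends-at-i B′) (sym (Blocks.ends-at-i B)) ⟩
    Blocks.origin B + a * r  ∎)
    where
    open ≡-Reasoning
    origin′ = Blocks.origin B′
    factor-out : ∀ x m u v → x + m * u + m * v ≡ x + m * (v + u)
    factor-out x m u v = solve (x ∷ m ∷ u ∷ v ∷ [])

  -- Two blocks at scales r < r′ < 2r overlap in an a/b-power of period b·(r′ - r): with δ = r′ - r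
  -- and a·δ = b·δ + d, the window [S, S + a·δ) with S = origin′ + d has period b·δ by the
  -- Fine–Wilf step applied to the periods b·r′ = b·δ + b·r and b·r of the two blocks.
  overlapping-blocks : ∀ {i r r′ j j′} → Blocks i r j → Blocks i r′ j′ → r < r′ → r′ < 2 * r → ⊥
  overlapping-blocks {i} {r} {r′} B B′ r<r′ r′<2r with m≤n⇒∃[o]m+o≡n r<r′
  ... | o , 1+r+o≡r′ with m≤n⇒∃[o]m+o≡n (*-monoˡ-≤ (suc o) (<⇒≤ b<a))
  ... | d , bδ+d≡aδ = pf S (a * δ) (periodic⇒power w S δ (s≤s z≤n) short-period)
    where
    open Blocks B using (origin; ends-at-i; periodic)
    open Blocks B′ using () renaming (origin to origin′; periodic to periodic′)
    δ = suc o
    r+δ≡r′ : r + δ ≡ r′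
    r+δ≡r′ = trans (+-suc r o) 1+r+o≡r′
    δ<r : δ < r
    δ<r = +-cancelˡ-< r δ r (subst₂ _<_ (sym r+δ≡r′) (cong (r +_) (+-identityʳ r)) r′<2r)
    S = origin′ + d
    S+bδ≡origin : S + b * δ ≡ origin
    S+bδ≡origin = begin
      origin′ + d + b * δ    ≡⟨ +-assoc origin′ d (b * δ) ⟩
      origin′ + (d + b * δ)  ≡⟨ cong (origin′ +_) (trans (+-comm d (b * δ)) bδ+d≡aδ) ⟩
      origin′ + a * δ        ≡⟨ origin-shift B B′ r+δ≡r′ ⟩
      origin                 ∎
      where open ≡-Reasoning
    end≤i : S + a * δ + b * r ≤ i
    end≤i = ≤-pred (begin-strict
      S + a * δ + b * r      ≡⟨ +-assoc S (a * δ) (b * r) ⟩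
      S + (a * δ + b * r)    <⟨ +-monoʳ-< S (exchange-< b<a δ<r) ⟩
      S + (b * δ + a * r)    ≡⟨ sym (+-assoc S (b * δ) (a * r)) ⟩
      S + b * δ + a * r      ≡⟨ cong (_+ a * r) S+bδ≡origin ⟩
      origin + a * r         ≡⟨ ends-at-i ⟩
      suc i                  ∎)
      where open ≤-Reasoning
    br′≡bδ+br : b * r′ ≡ b * δ + b * r
    br′≡bδ+br = trans (cong (b *_) (sym r+δ≡r′)) (trans (*-distribˡ-+ b r δ) (+-comm (b * r) (b * δ)))
    long-period : HasPeriod w S (S + a * δ + b * r) (b * δ + b * r)
    long-period = HasPeriod-restrict (m≤m+n origin′ d) end≤i
      (subst (HasPeriod w origin′ i) br′≡bδ+br periodic′)
    inner-period : HasPeriod w (S + b * δ) (S + a * δ + b * r) (b * r)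
    inner-period = HasPeriod-restrict (≤-reflexive (sym S+bδ≡origin)) end≤i periodic
    short-period : HasPeriod w S (S + a * δ) (b * δ)
    short-period = period-difference long-period inner-period

  blocks-separated : ∀ {i r r′ j j′} → Blocks i r j → Blocks i r′ j′ → r ≤ r′ → r′ < 2 * r → j ≡ j′
  blocks-separated B B′ r≤r′ r′<2r with m≤n⇒m<n∨m≡n r≤r′
  ... | inj₁ r<r′ = ⊥-elim (overlapping-blocks B B′ r<r′ r′<2r)
  ... | inj₂ refl = trans (sym (Blocks.letter B)) (trans (cong w same-source) (Blocks.letter B′))
    where
    same-source : Blocks.source B ≡ Blocks.source B′
    same-source = +-cancelʳ-≡ _ _ _ (trans (Blocks.source+br B) (sym (Blocks.source+br B′)))

  same-dyadic-range : ∀ {i r r′ j j′} e → Blocks i r j → Blocks i r′ j′ →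
    2 ^ e ≤ r → r < 2 ^ suc e → 2 ^ e ≤ r′ → r′ < 2 ^ suc e → j ≡ j′
  same-dyadic-range {r = r} {r′} e B B′ lo hi lo′ hi′ with ≤-total r r′
  ... | inj₁ r≤r′ = blocks-separated B B′ r≤r′ (<-≤-trans hi′ (*-monoʳ-≤ 2 lo))
  ... | inj₂ r′≤r = sym (blocks-separated B′ B r′≤r (<-≤-trans hi (*-monoʳ-≤ 2 lo′)))

  -- A block at scale r occupies a·r ≥ 2r positions up to i.
  scale-bound : ∀ {i r j} → Blocks i r j → 2 * r ≤ suc i
  scale-bound {i} {r} B = begin
    2 * r                   ≤⟨ *-monoˡ-≤ r (≤-trans (s≤s (>-nonZero⁻¹ b)) b<a) ⟩
    a * r                   ≤⟨ m≤n+m (a * r) (Blocks.origin B) ⟩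
    Blocks.origin B + a * r ≡⟨ Blocks.ends-at-i B ⟩
    suc i                   ∎
    where open ≤-Reasoning

  competitor : ℕ → ℕ → Word
  competitor i j x with <-cmp x i
  ... | tri< _ _ _ = w x
  ... | tri≈ _ _ _ = j
  ... | tri> _ _ _ = suc (j + prefix-max w i) + x

  competitor-below : ∀ {i j x} → x < i → competitor i j x ≡ w x
  competitor-below {i} {j} {x} x<i with <-cmp x i
  ... | tri< _ _ _    = refl
  ... | tri≈ x≮i _ _ = ⊥-elim (x≮i x<i)
  ... | tri> x≮i _ _ = ⊥-elim (x≮i x<i)

  competitor-at : ∀ {i j} → competitor i j i ≡ j
  competitor-at {i} with <-cmp i i
  ... | tri< _ i≢i _ = ⊥-elim (i≢i refl)
  ... | tri≈ _ _ _   = refl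
  ... | tri> _ i≢i _ = ⊥-elim (i≢i refl)

  competitor-above : ∀ {i j x} → i < x → competitor i j x ≡ suc (j + prefix-max w i) + x
  competitor-above {i} {j} {x} i<x with <-cmp x i
  ... | tri< x<i _ _ = ⊥-elim (<-asym x<i i<x)
  ... | tri≈ _ x≡i _ = ⊥-elim (<-irrefl (sym x≡i) i<x)
  ... | tri> _ _ _   = refl

  competitor-≤ : ∀ i j x → competitor i j x ≤ suc (j + prefix-max w i) + x
  competitor-≤ i j x with <-cmp x i
  ... | tri< x<i _ _ = ≤-trans (≤-trans (≤-prefix-max w x<i) (m≤n+m _ (suc j))) (m≤m+n _ x)
  ... | tri≈ _ _ _   = ≤-trans (n≤1+n j) (≤-trans (s≤s (m≤m+n j _)) (m≤m+n _ x))
  ... | tri> _ _ _   = ≤-refl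

  competitor-fresh : ∀ i j x y → x < y → i < y → competitor i j x < competitor i j y
  competitor-fresh i j x y x<y i<y = begin-strict
    competitor i j x                ≤⟨ competitor-≤ i j x ⟩
    suc (j + prefix-max w i) + x    <⟨ +-monoʳ-< (suc (j + prefix-max w i)) x<y ⟩
    suc (j + prefix-max w i) + y    ≡⟨ sym (competitor-above i<y) ⟩
    competitor i j y                ∎
    where open ≤-Reasoning

  power-ending-at-i-blocks : ∀ {u i j r s} → (∀ x → x < i → u x ≡ w x) → u i ≡ j → 1 ≤ r →
    s + a * r ≡ suc i → HasPeriod u s (suc i) (b * r) → Blocks i r j
  power-ending-at-i-blocks {u} {i} {j} {r} {s} agree ui≡j 1≤r s+ar≡1+i per
    with m≤n⇒∃[o]m+o≡n (≤-pred (<-≤-trans (period<length 1≤r) (subst (a * r ≤_) s+ar≡1+i (m≤n+m (a * r) s))))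
  ... | y , br+y≡i = record
    { positive  = 1≤r
    ; origin    = s
    ; ends-at-i = s+ar≡1+i
    ; periodic  = HasPeriod-transfer agree (HasPeriod-restrict ≤-refl (n≤1+n i) per)
    ; source    = y
    ; source+br = y+br≡i
    ; letter    = wy≡j
    }
    where
    y+br≡i : y + b * r ≡ i
    y+br≡i = trans (+-comm y (b * r)) br+y≡i
    y<i : y < i
    y<i = subst (y <_) y+br≡i (m<m+n y (*-mono-≤ (>-nonZero⁻¹ b) 1≤r))
    s≤y : s ≤ y
    s≤y = +-cancelʳ-≤ (b * r) s y (≤-pred (subst (s + b * r <_)
      (trans s+ar≡1+i (cong suc (sym y+br≡i))) (+-monoʳ-< s (period<length 1≤r))))
    wy≡j : w y ≡ j
    wy≡j = begin
      w y              ≡⟨ sym (agree y y<i) ⟩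
      u y              ≡⟨ per y s≤y (subst (_< suc i) (sym y+br≡i) ≤-refl) ⟩
      u (y + b * r)    ≡⟨ cong u y+br≡i ⟩
      u i              ≡⟨ ui≡j ⟩
      j                ∎
      where open ≡-Reasoning

  -- If no scale blocks j at i, the competitor is a/b-power-free: a power ending before i lies in w,
  -- one ending at i is a block, and none can end after i because the letters there are fresh.
  competitor-power-free : ∀ i j → (∀ r → ¬ Blocks i r j) → PowerFree a b (competitor i j)
  competitor-power-free i j unblocked s n power
    with power⇒periodic (<⇒≤ b<a) (competitor i j) s n power
  ... | r , 1≤r , refl , per
    with m≤n⇒m<n∨m≡n (fresh-period-end (competitor-fresh i j) 0<br (+-monoʳ-< s (period<length 1≤r)) per)
    where
    0<br : 0 < b * r
    0<br = *-mono-≤ (>-nonZero⁻¹ b) 1≤r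
  ... | inj₁ end≤i   = pf s (a * r) (periodic⇒power w s r 1≤r (HasPeriod-transfer agree per))
    where
    agree : ∀ x → x < s + a * r → competitor i j x ≡ w x
    agree x x<end = competitor-below (<-≤-trans x<end (≤-pred end≤i))
  ... | inj₂ end≡1+i = unblocked r (power-ending-at-i-blocks (λ x → competitor-below) (competitor-at {i} {j}) 1≤r
    end≡1+i (subst (λ e → HasPeriod (competitor i j) s e (b * r)) end≡1+i per))

  -- In the lexicographically least a/b-power-free word every letter below w(i) is blocked at i,
  -- as otherwise the competitor would be a smaller power-free word (constructively: not not blocked).
  smaller-letter-blocked : (∀ u → PowerFree a b u → ¬ LexLess u w) →
    ∀ i j → j < w i → ¬ ¬ (∃[ r ] Blocks i r j)
  smaller-letter-blocked least i j j<wi unblocked =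
    least (competitor i j) (competitor-power-free i j (λ r B → unblocked (r , B)))
      (i , (λ x x<i → competitor-below x<i) , subst (_< w i) (sym (competitor-at {i} {j})) j<wi)

  -- k letters blocked at i force 2^k ≤ i + 1: their scales lie in pairwise distinct dyadic
  -- ranges, so one of them is at least 2^(k-1), while every scale r satisfies 2r ≤ i + 1.
  blocked-letters-bound : ∀ i k → (∀ j → j < k → ∃[ r ] Blocks i r j) → 2 ^ k ≤ suc i
  blocked-letters-bound i zero    _       = s≤s z≤n
  blocked-letters-bound i (suc m) blocked = begin
    2 * 2 ^ m          ≤⟨ *-monoʳ-≤ 2 (≤-trans (^-monoʳ-≤ 2 m≤exponent) (lower x)) ⟩
    2 * scale x        ≤⟨ scale-bound (block x) ⟩
    suc i              ∎
    where
    open ≤-Reasoning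
    scale : Fin (suc m) → ℕ
    scale x = proj₁ (blocked (toℕ x) (toℕ<n x))
    block : ∀ x → Blocks i (scale x) (toℕ x)
    block x = proj₂ (blocked (toℕ x) (toℕ<n x))
    range : ∀ x → ∃[ e ] (2 ^ e ≤ scale x × scale x < 2 ^ suc e)
    range x = dyadic (scale x) (Blocks.positive (block x))
    exponent : Fin (suc m) → ℕ
    exponent x = proj₁ (range x)
    lower : ∀ x → 2 ^ exponent x ≤ scale x
    lower x = proj₁ (proj₂ (range x))
    upper : ∀ x → scale x < 2 ^ suc (exponent x)
    upper x = proj₂ (proj₂ (range x))
    exponent-injective : ∀ {x y} → exponent x ≡ exponent y → x ≡ y
    exponent-injective {x} {y} ex≡ey = toℕ-injective (same-dyadic-range (exponent x) (block x) (block y)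
      (lower x) (upper x)
      (subst (λ e → 2 ^ e ≤ scale y) (sym ex≡ey) (lower y))
      (subst (λ e → scale y < 2 ^ suc e) (sym ex≡ey) (upper y)))
    largest = injective-unbounded m exponent exponent-injective
    x = proj₁ largest
    m≤exponent : m ≤ exponent x
    m≤exponent = proj₂ largest

-- Theorem 2.9: w_{a/b}(i) = O(√i); explicitly w(i)² ≤ 4i for every i.
theorem2p9 : (a b : ℕ) .{{_ : NonZero b}} → Coprime a b → b < a →
    (w : Word) → IsLexLeastPowerFree a b w →
    ∃[ C ] ∃[ N ] (∀ i → N ≤ i → w i * w i ≤ C * i)
theorem2p9 a b _ b<a w (power-free , least) = 4 , 0 , λ i _ → letter-bound i
  where
  open PowerFreeWord a b b<a w power-free
  -- All letters below w(i) are blocked at i, which forces 2^w(i) ≤ i + 1; the latter is decidable,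
  -- so its double negation suffices.
  letter-bound : ∀ i → w i * w i ≤ 4 * i
  letter-bound i = square-bound {w i} (decidable-stable (2 ^ w i ≤? suc i)
    (¬¬-map (blocked-letters-bound i (w i)) (¬¬-bounded-∀ (w i) (smaller-letter-blocked least i))))
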